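{- Let $n=2m>3$ be an even integer and let $a,b$ be natural numbers with $1\le a<b\le n-1$. If $a$ and $b$ are both odd and $\gcd(a+b,n)=2$, then $a$ and $b$ always induce an $n$-polygon with $m$ axes, i.e. the $n$-tuple of sides $(a,b,a,b,\ldots,a,b)$ represents an $n$-polygon with $m$ axes.
   Context: Fix the vertices $v_k=e^{2\pi i k/n}$, $k=0,\ldots,n-1$, on the unit circle. An $n$-polygon is a Hamiltonian cycle through these vertices: a closed path $v_{\sigma_1}\cdots v_{\sigma_n}v_{\sigma_1}$ of straight segments with $(\sigma_1,\ldots,\sigma_n)$ an ordering of $0,\ldots,n-1$. Its sides are the integers $e_i\in\{1,\ldots,n-1\}$ with $e_i\equiv\sigma_{i+1}-\sigma_i\pmod n$; an $n$-tuple of sides represents a polygon if starting at a vertex and moving counterclockwise successively by the sides visits each vertex exactly once before returning to the start after the $n$-th step. An $n$-polygon with $m$ axes is one with exactly $m$ axes of reflection symmetry. -}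

module Defs where

open import Data.Nat using (ℕ; zero; suc; _+_; _*_; _∸_; _≤_; _<_; _%_; _≡ᵇ_; NonZero)
open import Data.Nat.GCD public using (gcd)
open import Data.Fin using (Fin; toℕ)
open import Data.Vec using (Vec; []; _∷_; lookup; map; tabulate; sum)
open import Data.Vec.Relation.Unary.All using (All)
open import Data.List using (List; length)
open import Data.List.Relation.Unary.Unique.Propositional using (Unique)
open import Data.List.Membership.Propositional using (_∈_)
open import Data.Product using (Σ; ∃; _×_)
open import Data.Sum using (_⊎_)
open import Data.Bool using (if_then_else_)
open import Relation.Binary.PropositionalEquality using (_≡_)

-- Vertices are identified with their indices k ∈ {0,…,n-1} (v_k = e^{2πik/n}).
-- A side tuple is a vector e = (e_0,…,e_{n-1}) of naturals.

scanPre : ∀ {n} → ℕ → Vec ℕ n → Vec ℕ n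
scanPre acc []       = []
scanPre acc (x ∷ xs) = acc ∷ scanPre (acc + x) xs

vertexSeq : (n : ℕ) .{{_ : NonZero n}} → Vec ℕ n → Vec ℕ n
vertexSeq n e = map (_% n) (scanPre 0 e)

ValidSides : (n : ℕ) → Vec ℕ n → Set
ValidSides n e = All (λ x → 1 ≤ x × x ≤ n ∸ 1) e

-- e represents an n-polygon: starting at vertex 0 and moving counterclockwise
-- successively by the sides, the first n visited vertices are pairwise distinct
-- and the n-th step returns to the start.
RepresentsPolygon : (n : ℕ) .{{_ : NonZero n}} → Vec ℕ n → Set
RepresentsPolygon n e =
  ValidSides n e
  × (∀ i j → lookup (vertexSeq n e) i ≡ lookup (vertexSeq n e) j → i ≡ j)
  × (sum e % n ≡ 0)

-- the i-th side joins σ_i and σ_i + e_i (mod n) (for i = n-1 this is σ_0)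
edgeStart edgeEnd : (n : ℕ) .{{_ : NonZero n}} → Vec ℕ n → Fin n → ℕ
edgeStart n e i = lookup (vertexSeq n e) i
edgeEnd   n e i = (lookup (vertexSeq n e) i + lookup e i) % n

SamePair : ℕ → ℕ → ℕ → ℕ → Set
SamePair x y x' y' = (x ≡ x' × y ≡ y') ⊎ (x ≡ y' × y ≡ x')

-- the reflection symmetries of the regular n-gon vertex set: k ↦ j - k (mod n), j ∈ Z_n
reflect : (n : ℕ) .{{_ : NonZero n}} → Fin n → ℕ → ℕ
reflect n j k = (toℕ j + (n ∸ k)) % n

IsAxis : (n : ℕ) .{{_ : NonZero n}} → Vec ℕ n → Fin n → Set
IsAxis n e j = ∀ i → ∃ λ i' →
  SamePair (reflect n j (edgeStart n e i)) (reflect n j (edgeEnd n e i))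
           (edgeStart n e i') (edgeEnd n e i')

HasExactlyAxes : (n : ℕ) .{{_ : NonZero n}} → Vec ℕ n → ℕ → Set
HasExactlyAxes n e m = Σ (List (Fin n)) λ L →
  Unique L × length L ≡ m × (∀ j → (IsAxis n e j → j ∈ L) × (j ∈ L → IsAxis n e j))

alternating : (n : ℕ) → ℕ → ℕ → Vec ℕ n
alternating n a b = tabulate (λ i → if toℕ i % 2 ≡ᵇ 0 then a else b)

-- Write n = 2m and a + b = 2t; then gcd (a + b, n) = 2 says gcd (t, m) = 1. After k = 2q + r steps
-- (r < 2) the walk is at σ k = q (a + b) + r a, and σ k ≡ k (mod 2) because every step is odd. Two
-- vertices of equal parity differ by (q − q') 2t, so gcd (t, m) = 1 makes σ 0, …, σ (n − 1)
-- distinct modulo n, and the walk closes since σ n = t n. The reflection x ↦ j − x maps the side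
-- {σ k, σ (k+1)} onto a side {σ k', σ (k'+1)} only if σ k + σ k' ≡ j or σ k + σ (k'+1) ≡ j, which
-- fixes the parity of k' and hence the length of side k'. For odd j that length equals the length
-- of side k, so every side has a mirror image among the sides and the m odd j are axes. For even j
-- the first two sides force 2a ≡ 0 ≡ 2b (mod n) or a ≡ b, i.e. 2a = n = 2b, contradicting a < b.
module Submission where

open import Defs
open import Data.Nat using (ℕ; _+_; _*_; _∸_; _≤_; _<_; _%_; NonZero)
open import Data.Product using (_×_)
open import Relation.Binary.PropositionalEquality using (_≡_)

open import Data.Bool using (true; false; if_then_else_)
open import Data.Empty using (⊥; ⊥-elim)
open import Data.Fin as Fin using (Fin; toℕ)
import Data.Fin.Properties as FinP
open import Data.Integer as ℤ using (ℤ; +_; ∣_∣)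
import Data.Integer.Coprimality as ℤ
open import Data.Integer.Divisibility.Signed
import Data.Integer.Properties as ℤ
open import Data.Integer.Tactic.RingSolver using (solve-∀)
import Data.List as List
open import Data.List.Membership.Propositional using (_∈_)
open import Data.List.Membership.Propositional.Properties using (∈-tabulate⁺; ∈-tabulate⁻)
import Data.List.Properties as List
import Data.List.Relation.Unary.Unique.Propositional.Properties as Unique
open import Data.Nat as ℕ using (zero; suc; _/_; parity; _≡ᵇ_)
open import Data.Nat.Coprimality using (Coprime; gcd≡1⇒coprime)
open import Data.Nat.DivMod using (m%n<n; m%n≤n; m%n%n≡m%n; m≡m%n+[m/n]*n; m*n%n≡0; m<n*o⇒m/o<n; %-distribˡ-+)
import Data.Nat.Divisibility as ℕ
open import Data.Nat.GCD using (gcd-comm; c*gcd[m,n]≡gcd[cm,cn])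
import Data.Nat.Properties as ℕ
open import Data.Nat.Tactic.RingSolver using () renaming (solve-∀ to ℕ-solve-∀)
open import Data.Parity as ℙ using (0ℙ; 1ℙ)
import Data.Parity.Properties as ℙ
open import Data.Product as Prod using (_,_; ∃)
open import Data.Sum as Sum using (_⊎_; inj₁; inj₂)
open import Data.Vec using (Vec; lookup; tabulate; sum)
import Data.Vec.Properties as Vec
import Data.Vec.Relation.Unary.All.Properties as All
open import Function using (_∘_)
open import Function.Bundles using (_⇔_; mk⇔; Equivalence)
open import Function.Definitions using (Injective; StrictlySurjective)
open import Relation.Binary.Bundles using (Setoid)
import Relation.Binary.PropositionalEquality as ≡
open ≡ using (refl; cong; cong₂; subst)
import Relation.Binary.Reasoning.Setoid as SetoidReasoning
open import Relation.Binary.Structures using (IsEquivalence)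
open import Relation.Nullary using (yes; no; contradiction)

-- Congruence modulo n on ℤ

infix 4 _≡_mod_

-- A record rather than a function into _∣_, so that x and y can be inferred from a proof.
record _≡_mod_ (x y : ℤ) (n : ℕ) : Set where
  constructor ≡mod
  field divides-difference : + n ∣ x ℤ.- y

module _ {n : ℕ} where

  ≡mod-reflexive : ∀ {x y} → x ≡ y → x ≡ y mod n
  ≡mod-reflexive {x} refl = ≡mod (subst (+ n ∣_) (≡.sym (ℤ.+-inverseʳ x)) (divides (+ 0) refl))

  ≡mod-refl : ∀ {x} → x ≡ x mod n
  ≡mod-refl = ≡mod-reflexive refl

  ≡mod-sym : ∀ {x y} → x ≡ y mod n → y ≡ x mod n
  ≡mod-sym {x} {y} (≡mod n∣x-y) = ≡mod (subst (+ n ∣_) (negate x y) (∣m⇒∣-m n∣x-y))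
    where negate : ∀ x y → ℤ.- (x ℤ.- y) ≡ y ℤ.- x
          negate = solve-∀

  ≡mod-trans : ∀ {x y z} → x ≡ y mod n → y ≡ z mod n → x ≡ z mod n
  ≡mod-trans {x} {y} {z} (≡mod n∣x-y) (≡mod n∣y-z) =
    ≡mod (subst (+ n ∣_) (telescope x y z) (∣m∣n⇒∣m+n n∣x-y n∣y-z))
    where telescope : ∀ x y z → (x ℤ.- y) ℤ.+ (y ℤ.- z) ≡ x ℤ.- z
          telescope = solve-∀

  ≡mod-isEquivalence : IsEquivalence (λ x y → x ≡ y mod n)
  ≡mod-isEquivalence = record { refl = ≡mod-refl ; sym = ≡mod-sym ; trans = ≡mod-trans }

  +-cong-≡mod : ∀ {x y u v} → x ≡ y mod n → u ≡ v mod n → x ℤ.+ u ≡ y ℤ.+ v mod n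
  +-cong-≡mod {x} {y} {u} {v} (≡mod n∣x-y) (≡mod n∣u-v) =
    ≡mod (subst (+ n ∣_) (regroup x y u v) (∣m∣n⇒∣m+n n∣x-y n∣u-v))
    where regroup : ∀ x y u v → (x ℤ.- y) ℤ.+ (u ℤ.- v) ≡ (x ℤ.+ u) ℤ.- (y ℤ.+ v)
          regroup = solve-∀

  +-cancelˡ-≡mod : ∀ {x y} z → z ℤ.+ x ≡ z ℤ.+ y mod n → x ≡ y mod n
  +-cancelˡ-≡mod {x} {y} z (≡mod n∣difference) = ≡mod (subst (+ n ∣_) (cancel x y z) n∣difference)
    where cancel : ∀ x y z → (z ℤ.+ x) ℤ.- (z ℤ.+ y) ≡ x ℤ.- y
          cancel = solve-∀

  %-≡mod : ∀ x .{{_ : NonZero n}} → + (x % n) ≡ + x mod n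
  %-≡mod x = ≡mod-sym (≡mod (divides (+ (x / n)) (begin
    + x ℤ.- + (x % n)                                  ≡⟨ cong (ℤ._- + (x % n)) divMod ⟩
    (+ (x % n) ℤ.+ + (x / n) ℤ.* + n) ℤ.- + (x % n)    ≡⟨ cancel (+ (x % n)) (+ (x / n)) (+ n) ⟩
    + (x / n) ℤ.* + n                                  ∎)))
    where
      open ≡.≡-Reasoning
      divMod : + x ≡ + (x % n) ℤ.+ + (x / n) ℤ.* + n
      divMod = ≡.trans (cong +_ (m≡m%n+[m/n]*n x n))
                 (≡.trans (ℤ.pos-+ (x % n) _) (cong (λ w → + (x % n) ℤ.+ w) (ℤ.pos-* (x / n) n)))
      cancel : ∀ r q n → (r ℤ.+ q ℤ.* n) ℤ.- r ≡ q ℤ.* n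
      cancel = solve-∀

  %≡⇒≡mod : ∀ {x y} .{{_ : NonZero n}} → x % n ≡ y % n → + x ≡ + y mod n
  %≡⇒≡mod {x} {y} x%n≡y%n =
    ≡mod-trans (≡mod-sym (%-≡mod x)) (≡mod-trans (≡mod-reflexive (cong +_ x%n≡y%n)) (%-≡mod y))

  private
    multiple<n⇒0 : ∀ {d} → d < n → n ℕ.∣ d → d ≡ 0
    multiple<n⇒0 {zero}  _   _   = refl
    multiple<n⇒0 {suc _} d<n n∣d = ⊥-elim (ℕ.>⇒∤ d<n n∣d)

    ≤-≡mod⇒≡ : ∀ {x y} → x ≤ y → y < n → + x ≡ + y mod n → x ≡ y
    ≤-≡mod⇒≡ {x} {y} x≤y y<n (≡mod n∣x-y) =
      ℕ.≤-antisym x≤y (ℕ.m∸n≡0⇒m≤n (multiple<n⇒0 (ℕ.≤-<-trans (ℕ.m∸n≤m y x) y<n) n∣y∸x))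
      where n∣y∸x : n ℕ.∣ y ∸ x
            n∣y∸x = subst (n ℕ.∣_) (≡.trans (cong ∣_∣ (ℤ.[+m]-[+n]≡m⊖n x y)) (ℤ.∣⊖∣-≤ x≤y))
                          (∣⇒∣ᵤ n∣x-y)

  ≡mod⇒≡ : ∀ {x y} → x < n → y < n → + x ≡ + y mod n → x ≡ y
  ≡mod⇒≡ {x} {y} x<n y<n x≡y with ℕ.≤-total x y
  ... | inj₁ x≤y = ≤-≡mod⇒≡ x≤y y<n x≡y
  ... | inj₂ y≤x = ≡.sym (≤-≡mod⇒≡ y≤x x<n (≡mod-sym x≡y))

  ≡mod-divisor : ∀ {d x y} → d ℕ.∣ n → x ≡ y mod n → x ≡ y mod d
  ≡mod-divisor d∣n (≡mod n∣x-y) = ≡mod (∣-trans (∣ᵤ⇒∣ d∣n) n∣x-y)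

  double≡0-mod⇒double≡n : ∀ {x} → 0 < x → x < n → + x ℤ.+ + x ≡ + 0 mod n → x + x ≡ n
  double≡0-mod⇒double≡n {x} 0<x x<n (≡mod n∣2x)
    with subst (n ℕ.∣_) (ℕ.+-identityʳ (x + x)) (∣⇒∣ᵤ n∣2x)
  ... | ℕ.divides zero          2x≡0  = ⊥-elim (ℕ.<-irrefl (≡.sym 2x≡0) (ℕ.<-≤-trans 0<x (ℕ.m≤m+n x x)))
  ... | ℕ.divides 1             2x≡n  = ≡.trans 2x≡n (ℕ.+-identityʳ n)
  ... | ℕ.divides (suc (suc q)) 2x≡qn =
    ⊥-elim (ℕ.<-irrefl 2x≡qn (ℕ.<-≤-trans (ℕ.+-mono-< x<n x<n) (ℕ.+-monoʳ-≤ n (ℕ.m≤m+n n (q * n)))))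

≡mod-setoid : ℕ → Setoid _ _
≡mod-setoid n = record { isEquivalence = ≡mod-isEquivalence {n} }

module ≡mod-Reasoning (n : ℕ) = SetoidReasoning (≡mod-setoid n)

*-cancelʳ-≡mod : ∀ d {m t x y} .{{_ : NonZero d}} → Coprime m t →
                 x ℤ.* + (d * t) ≡ y ℤ.* + (d * t) mod (d * m) → x ≡ y mod m
*-cancelʳ-≡mod d {m} {t} {x} {y} m⊥t (≡mod dm∣difference) =
  ≡mod (∣ᵤ⇒∣ (ℤ.coprime-divisor (+ m) (+ t) (x ℤ.- y) m⊥t m∣t[x-y]))
  where
    factor : ∀ d t x y → x ℤ.* (d ℤ.* t) ℤ.- y ℤ.* (d ℤ.* t) ≡ d ℤ.* ((x ℤ.- y) ℤ.* t)
    factor = solve-∀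
    dm∣d[x-y]t : + d ℤ.* + m ∣ + d ℤ.* ((x ℤ.- y) ℤ.* + t)
    dm∣d[x-y]t = ≡.subst₂ _∣_ (ℤ.pos-* d m)
      (≡.trans (cong (λ w → x ℤ.* w ℤ.- y ℤ.* w) (ℤ.pos-* d t)) (factor (+ d) (+ t) x y)) dm∣difference
    m∣t[x-y] : m ℕ.∣ ∣ + t ℤ.* (x ℤ.- y) ∣
    m∣t[x-y] = subst (λ w → m ℕ.∣ ∣ w ∣) (ℤ.*-comm (x ℤ.- y) (+ t))
                     (∣⇒∣ᵤ (*-cancelˡ-∣ (+ d) dm∣d[x-y]t))

gcd[dt,dm]≡d⇒coprime : ∀ d {t m} .{{_ : NonZero d}} → gcd (d * t) (d * m) ≡ d → Coprime m t
gcd[dt,dm]≡d⇒coprime d {t} {m} gcd≡d =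
  gcd≡1⇒coprime (≡.trans (gcd-comm m t) (ℕ.*-cancelˡ-≡ (gcd t m) 1 d (begin
    d * gcd t m           ≡⟨ c*gcd[m,n]≡gcd[cm,cn] d t m ⟩
    gcd (d * t) (d * m)   ≡⟨ gcd≡d ⟩
    d                     ≡⟨ ℕ.*-identityʳ d ⟨
    d * 1                 ∎)))
  where open ≡.≡-Reasoning

-- Parity

parity[m%2]≡parity[m] : ∀ m → parity (m % 2) ≡ parity m
parity[m%2]≡parity[m] 0             = refl
parity[m%2]≡parity[m] 1             = refl
parity[m%2]≡parity[m] (suc (suc m)) = parity[m%2]≡parity[m] m

parity-≡⇒%2-≡ : ∀ m n → parity m ≡ parity n → m % 2 ≡ n % 2
parity-≡⇒%2-≡ (suc (suc m)) n             p = parity-≡⇒%2-≡ m n p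
parity-≡⇒%2-≡ 0             (suc (suc n)) p = parity-≡⇒%2-≡ 0 n p
parity-≡⇒%2-≡ 1             (suc (suc n)) p = parity-≡⇒%2-≡ 1 n p
parity-≡⇒%2-≡ 0             0             _ = refl
parity-≡⇒%2-≡ 1             1             _ = refl

m%2≡1⇒parity≡1ℙ : ∀ m → m % 2 ≡ 1 → parity m ≡ 1ℙ
m%2≡1⇒parity≡1ℙ m m%2≡1 = ≡.trans (≡.sym (parity[m%2]≡parity[m] m)) (cong parity m%2≡1)

m≡[m/2]*2+m%2 : ∀ m → m ≡ m / 2 * 2 + m % 2
m≡[m/2]*2+m%2 m = ≡.trans (m≡m%n+[m/n]*n m 2) (ℕ.+-comm (m % 2) _)

m<2n⇒m/2<n : ∀ {m n} → m < 2 * n → m / 2 < n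
m<2n⇒m/2<n {m} {n} m<2n = m<n*o⇒m/o<n (subst (m <_) (ℕ.*-comm 2 n) m<2n)

even⇒m≡2*[m/2] : ∀ {m} → parity m ≡ 0ℙ → m ≡ 2 * (m / 2)
even⇒m≡2*[m/2] {m} m-even = begin
  m                   ≡⟨ m≡[m/2]*2+m%2 m ⟩
  m / 2 * 2 + m % 2   ≡⟨ cong (λ r → m / 2 * 2 + r) (parity-≡⇒%2-≡ m 0 m-even) ⟩
  m / 2 * 2 + 0       ≡⟨ ℕ.+-identityʳ _ ⟩
  m / 2 * 2           ≡⟨ ℕ.*-comm (m / 2) 2 ⟩
  2 * (m / 2)         ∎
  where open ≡.≡-Reasoning

odd⇒m≡1+2*[m/2] : ∀ {m} → parity m ≡ 1ℙ → m ≡ suc (2 * (m / 2))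
odd⇒m≡1+2*[m/2] {m} m-odd = begin
  m                   ≡⟨ m≡[m/2]*2+m%2 m ⟩
  m / 2 * 2 + m % 2   ≡⟨ cong (λ r → m / 2 * 2 + r) (parity-≡⇒%2-≡ m 1 m-odd) ⟩
  m / 2 * 2 + 1       ≡⟨ ℕ.+-comm _ 1 ⟩
  suc (m / 2 * 2)     ≡⟨ cong suc (ℕ.*-comm (m / 2) 2) ⟩
  suc (2 * (m / 2))   ∎
  where open ≡.≡-Reasoning

parity[1+2m]≡1ℙ : ∀ m → parity (suc (2 * m)) ≡ 1ℙ
parity[1+2m]≡1ℙ m = ≡.trans (ℙ.+-homo-+ 1 (2 * m)) (cong (1ℙ ℙ.+_) (ℙ.*-homo-* 2 m))

≡mod-parity : ∀ {n x y} → 2 ℕ.∣ n → + x ≡ + y mod n → parity x ≡ parity y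
≡mod-parity {x = x} {y} 2∣n x≡y = begin
  parity x         ≡⟨ parity[m%2]≡parity[m] x ⟨
  parity (x % 2)   ≡⟨ cong parity (≡mod⇒≡ (m%n<n x 2) (m%n<n y 2) remainders≡) ⟩
  parity (y % 2)   ≡⟨ parity[m%2]≡parity[m] y ⟩
  parity y         ∎
  where
    open ≡.≡-Reasoning
    remainders≡ : + (x % 2) ≡ + (y % 2) mod 2
    remainders≡ = ≡mod-trans (%-≡mod x) (≡mod-trans (≡mod-divisor 2∣n x≡y) (≡mod-sym (%-≡mod y)))

private
  ℙ-solveʳ : ∀ p {q r} → p ℙ.+ q ≡ r → q ≡ p ℙ.+ r
  ℙ-solveʳ 0ℙ      refl = refl
  ℙ-solveʳ 1ℙ {0ℙ} refl = refl
  ℙ-solveʳ 1ℙ {1ℙ} refl = refl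

-- Reflections of the vertex set ℤ/n

reflect-≡mod : ∀ n .{{_ : NonZero n}} (j : Fin n) u → + u ℤ.+ + reflect n j (u % n) ≡ + toℕ j mod n
reflect-≡mod n j u = begin
  + u ℤ.+ + reflect n j (u % n)             ≈⟨ +-cong-≡mod (≡mod-sym (%-≡mod u)) (%-≡mod (toℕ j + (n ∸ r))) ⟩
  + r ℤ.+ + (toℕ j + (n ∸ r))               ≡⟨ ℤ.pos-+ r _ ⟨
  + (r + (toℕ j + (n ∸ r)))                 ≡⟨ cong +_ (cancel-∸ r (toℕ j) (m%n≤n u n)) ⟩
  + (toℕ j + n)                             ≡⟨ ℤ.pos-+ (toℕ j) n ⟩
  + toℕ j ℤ.+ + n                           ≈⟨ ≡mod (divides (+ 1) (drop-n (+ toℕ j) (+ n))) ⟩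
  + toℕ j                                   ∎
  where
    open ≡mod-Reasoning n
    r = u % n
    cancel-∸ : ∀ r j → r ≤ n → r + (j + (n ∸ r)) ≡ j + n
    cancel-∸ r j r≤n =
      ≡.trans (ℕ.+-comm r (j + (n ∸ r))) (≡.trans (ℕ.+-assoc j (n ∸ r) r) (cong (_+_ j) (ℕ.m∸n+n≡m r≤n)))
    drop-n : ∀ x n → (x ℤ.+ n) ℤ.- x ≡ + 1 ℤ.* n
    drop-n = solve-∀

reflect≡⇔ : ∀ n .{{_ : NonZero n}} (j : Fin n) u x →
            (reflect n j (u % n) ≡ x % n) ⇔ (+ u ℤ.+ + x ≡ + toℕ j mod n)
reflect≡⇔ n j u x = mk⇔ to from
  where
    open ≡mod-Reasoning n
    to : reflect n j (u % n) ≡ x % n → + u ℤ.+ + x ≡ + toℕ j mod n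
    to reflection≡x = begin
      + u ℤ.+ + x                       ≈⟨ +-cong-≡mod (≡mod-refl {x = + u}) (≡mod-sym (%-≡mod x)) ⟩
      + u ℤ.+ + (x % n)                 ≡⟨ cong (λ w → + u ℤ.+ + w) reflection≡x ⟨
      + u ℤ.+ + reflect n j (u % n)     ≈⟨ reflect-≡mod n j u ⟩
      + toℕ j                           ∎
    from : + u ℤ.+ + x ≡ + toℕ j mod n → reflect n j (u % n) ≡ x % n
    from u+x≡j = ≡mod⇒≡ (m%n<n _ n) (m%n<n x n) (+-cancelˡ-≡mod (+ u) (begin
      + u ℤ.+ + reflect n j (u % n)     ≈⟨ reflect-≡mod n j u ⟩
      + toℕ j                           ≈⟨ u+x≡j ⟨
      + u ℤ.+ + x                       ≈⟨ +-cong-≡mod (≡mod-refl {x = + u}) (%-≡mod x) ⟨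
      + u ℤ.+ + (x % n)                 ∎))

-- u + x ≡ j says that x is the mirror image j − u of u in the axis j.
ReflectsOnto : ℕ → ℤ → ℤ → ℤ → ℤ → ℤ → Set
ReflectsOnto n j u v x y =
  (u ℤ.+ x ≡ j mod n × v ℤ.+ y ≡ j mod n) ⊎ (u ℤ.+ y ≡ j mod n × v ℤ.+ x ≡ j mod n)

samePair-reflect⇔ : ∀ n .{{_ : NonZero n}} (j : Fin n) u v x y →
  SamePair (reflect n j (u % n)) (reflect n j (v % n)) (x % n) (y % n) ⇔
  ReflectsOnto n (+ toℕ j) (+ u) (+ v) (+ x) (+ y)
samePair-reflect⇔ n j u v x y = mk⇔
  (Sum.map (Prod.map (to u x) (to v y)) (Prod.map (to u y) (to v x)))
  (Sum.map (Prod.map (from u x) (from v y)) (Prod.map (from u y) (from v x)))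
  where
    to   = λ u x → Equivalence.to (reflect≡⇔ n j u x)
    from = λ u x → Equivalence.from (reflect≡⇔ n j u x)

-- Walks with prescribed steps

partialSum : (ℕ → ℕ) → ℕ → ℕ
partialSum g zero    = 0
partialSum g (suc k) = partialSum g k + g k

partialSum-suc : ∀ g k → partialSum g (suc k) ≡ g 0 + partialSum (g ∘ suc) k
partialSum-suc g zero    = ℕ.+-comm 0 (g 0)
partialSum-suc g (suc k) = ≡.trans (cong (_+ g (suc k)) (partialSum-suc g k)) (ℕ.+-assoc (g 0) _ _)

lookup-scanPre-tabulate : ∀ {k} g acc (i : Fin k) →
                          lookup (scanPre acc (tabulate (g ∘ toℕ))) i ≡ acc + partialSum g (toℕ i)
lookup-scanPre-tabulate g acc Fin.zero    = ≡.sym (ℕ.+-identityʳ acc)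
lookup-scanPre-tabulate g acc (Fin.suc i) = begin
  lookup (scanPre (acc + g 0) (tabulate (g ∘ suc ∘ toℕ))) i   ≡⟨ lookup-scanPre-tabulate (g ∘ suc) (acc + g 0) i ⟩
  acc + g 0 + partialSum (g ∘ suc) (toℕ i)                    ≡⟨ ℕ.+-assoc acc (g 0) _ ⟩
  acc + (g 0 + partialSum (g ∘ suc) (toℕ i))                  ≡⟨ cong (_+_ acc) (partialSum-suc g (toℕ i)) ⟨
  acc + partialSum g (suc (toℕ i))                            ∎
  where open ≡.≡-Reasoning

sum-tabulate : ∀ k g → sum (tabulate {n = k} (g ∘ toℕ)) ≡ partialSum g k
sum-tabulate zero    g = refl
sum-tabulate (suc k) g = ≡.trans (cong (_+_ (g 0)) (sum-tabulate k (g ∘ suc))) (≡.sym (partialSum-suc g k))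

partialSum-parity : ∀ {g} → (∀ k → parity (g k) ≡ 1ℙ) → ∀ k → parity (partialSum g k) ≡ parity k
partialSum-parity     g-odd zero    = refl
partialSum-parity {g} g-odd (suc k) = begin
  parity (partialSum g k + g k)              ≡⟨ ℙ.+-homo-+ (partialSum g k) (g k) ⟩
  parity (partialSum g k) ℙ.+ parity (g k)   ≡⟨ cong₂ ℙ._+_ (partialSum-parity g-odd k) (g-odd k) ⟩
  parity k ℙ.+ 1ℙ                            ≡⟨ ℙ.+-homo-+ k 1 ⟨
  parity (k + 1)                             ≡⟨ cong parity (ℕ.+-comm k 1) ⟩
  parity (suc k)                             ∎
  where open ≡.≡-Reasoning

[m%n+k]%n≡[m+k]%n : ∀ m k n .{{_ : NonZero n}} → (m % n + k) % n ≡ (m + k) % n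
[m%n+k]%n≡[m+k]%n m k n = begin
  (m % n + k) % n           ≡⟨ %-distribˡ-+ (m % n) k n ⟩
  (m % n % n + k % n) % n   ≡⟨ cong (λ r → (r + k % n) % n) (m%n%n≡m%n m n) ⟩
  (m % n + k % n) % n       ≡⟨ %-distribˡ-+ m k n ⟨
  (m + k) % n               ∎
  where open ≡.≡-Reasoning

module _ (n : ℕ) .{{_ : NonZero n}} (g : ℕ → ℕ) where

  edgeStart-tabulate : ∀ i → edgeStart n (tabulate (g ∘ toℕ)) i ≡ partialSum g (toℕ i) % n
  edgeStart-tabulate i = ≡.trans (Vec.lookup-map i (_% n) (scanPre 0 (tabulate (g ∘ toℕ))))
                                 (cong (_% n) (lookup-scanPre-tabulate g 0 i))

  edgeEnd-tabulate : ∀ i → edgeEnd n (tabulate (g ∘ toℕ)) i ≡ partialSum g (suc (toℕ i)) % n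
  edgeEnd-tabulate i = ≡.trans
    (cong₂ (λ u v → (u + v) % n) (edgeStart-tabulate i) (Vec.lookup∘tabulate (g ∘ toℕ) i))
    ([m%n+k]%n≡[m+k]%n (partialSum g (toℕ i)) (g (toℕ i)) n)

MapsEdge : ℕ → (ℕ → ℕ) → ℕ → ℕ → ℕ → Set
MapsEdge n g j k k' = ReflectsOnto n (+ j) (+ partialSum g k) (+ partialSum g (suc k))
                                           (+ partialSum g k') (+ partialSum g (suc k'))

isAxis-tabulate⇔ : ∀ n .{{_ : NonZero n}} g (j : Fin n) →
  IsAxis n (tabulate (g ∘ toℕ)) j ⇔ (∀ i → ∃ λ i' → MapsEdge n g (toℕ j) (toℕ i) (toℕ i'))
isAxis-tabulate⇔ n g j = mk⇔
  (λ axis i → Prod.map₂ (λ {i'} → Equivalence.to (edge⇔ i i')) (axis i))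
  (λ maps i → Prod.map₂ (λ {i'} → Equivalence.from (edge⇔ i i')) (maps i))
  where
    e = tabulate (g ∘ toℕ)
    edge⇔ : ∀ i i' → SamePair (reflect n j (edgeStart n e i)) (reflect n j (edgeEnd n e i))
                              (edgeStart n e i') (edgeEnd n e i')
                     ⇔ MapsEdge n g (toℕ j) (toℕ i) (toℕ i')
    edge⇔ i i' rewrite edgeEnd-tabulate n g i | edgeEnd-tabulate n g i'
                     | edgeStart-tabulate n g i | edgeStart-tabulate n g i' =
      samePair-reflect⇔ n j _ _ _ _

-- If y were missed, punching y out of the codomain would inject Fin (suc N) into Fin N.
injective⇒strictlySurjective : ∀ {N} {f : Fin N → Fin N} → Injective _≡_ _≡_ f → StrictlySurjective _≡_ f
injective⇒strictlySurjective {suc N} {f} f-injective y with FinP.any? (λ x → f x FinP.≟ y)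
... | yes hit  = hit
... | no  miss = contradiction (FinP.injective⇒≤ avoid-y-injective) (ℕ.<-irrefl refl)
  where
    avoid-y : Fin (suc N) → Fin N
    avoid-y x = Fin.punchOut {i = y} {j = f x} (λ y≡fx → miss (x , ≡.sym y≡fx))
    avoid-y-injective : Injective _≡_ _≡_ avoid-y
    avoid-y-injective {x} {x'} = f-injective ∘ FinP.punchOut-injective (λ y≡fx → miss (x , ≡.sym y≡fx))
                                                                       (λ y≡fx' → miss (x' , ≡.sym y≡fx'))

DistinctVertices : ℕ → (ℕ → ℕ) → Set
DistinctVertices n g = ∀ {k k'} → k < n → k' < n → + partialSum g k ≡ + partialSum g k' mod n → k ≡ k'

module _ {n : ℕ} .{{_ : NonZero n}} {g : ℕ → ℕ} (distinct : DistinctVertices n g) where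

  private
    vertex : Fin n → Fin n
    vertex i = Fin.fromℕ< (m%n<n (partialSum g (toℕ i)) n)

    toℕ-vertex : ∀ i → toℕ (vertex i) ≡ partialSum g (toℕ i) % n
    toℕ-vertex i = FinP.toℕ-fromℕ< (m%n<n (partialSum g (toℕ i)) n)

    residues-injective : ∀ {i i'} → partialSum g (toℕ i) % n ≡ partialSum g (toℕ i') % n → i ≡ i'
    residues-injective {i} {i'} = FinP.toℕ-injective ∘ distinct (FinP.toℕ<n i) (FinP.toℕ<n i') ∘ %≡⇒≡mod

  vertexSeq-injective : ∀ i i' → lookup (vertexSeq n (tabulate (g ∘ toℕ))) i
                               ≡ lookup (vertexSeq n (tabulate (g ∘ toℕ))) i' → i ≡ i'
  vertexSeq-injective i i' eq =
    residues-injective (≡.trans (≡.sym (edgeStart-tabulate n g i)) (≡.trans eq (edgeStart-tabulate n g i')))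

  vertices-cover : ∀ v → ∃ λ (i : Fin n) → + partialSum g (toℕ i) ≡ + v mod n
  vertices-cover v =
    Prod.map₂ (λ {i} hit → %≡⇒≡mod (≡.trans (≡.sym (toℕ-vertex i))
                                            (≡.trans (cong toℕ hit) (FinP.toℕ-fromℕ< (m%n<n v n)))))
              (injective⇒strictlySurjective vertex-injective (Fin.fromℕ< (m%n<n v n)))
    where
      vertex-injective : Injective _≡_ _≡_ vertex
      vertex-injective {i} {i'} eq =
        residues-injective (≡.trans (≡.sym (toℕ-vertex i)) (≡.trans (cong toℕ eq) (toℕ-vertex i')))

oddAxes⇒hasExactlyAxes : ∀ {m} .{{_ : NonZero (2 * m)}} (e : Vec ℕ (2 * m)) →
                         (∀ j → IsAxis (2 * m) e j ⇔ parity (toℕ j) ≡ 1ℙ) → HasExactlyAxes (2 * m) e m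
oddAxes⇒hasExactlyAxes {m} e axis⇔odd =
  List.tabulate oddResidue , Unique.tabulate⁺ oddResidue-injective , List.length-tabulate oddResidue ,
  λ j → odd⇒∈ j ∘ Equivalence.to (axis⇔odd j) , Equivalence.from (axis⇔odd j) ∘ ∈⇒odd j
  where
    odd<2m : ∀ {k} → k < m → suc (2 * k) < 2 * m
    odd<2m {k} k<m = subst (_≤ 2 * m) (ℕ.*-suc 2 k) (ℕ.*-monoʳ-≤ 2 k<m)

    oddResidue : Fin m → Fin (2 * m)
    oddResidue k = Fin.fromℕ< (odd<2m (FinP.toℕ<n k))

    toℕ-oddResidue : ∀ k → toℕ (oddResidue k) ≡ suc (2 * toℕ k)
    toℕ-oddResidue k = FinP.toℕ-fromℕ< (odd<2m (FinP.toℕ<n k))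

    oddResidue-injective : ∀ {k k'} → oddResidue k ≡ oddResidue k' → k ≡ k'
    oddResidue-injective {k} {k'} eq = FinP.toℕ-injective (ℕ.*-cancelˡ-≡ (toℕ k) (toℕ k') 2 (ℕ.suc-injective
      (≡.trans (≡.sym (toℕ-oddResidue k)) (≡.trans (cong toℕ eq) (toℕ-oddResidue k')))))

    odd⇒∈ : ∀ j → parity (toℕ j) ≡ 1ℙ → j ∈ List.tabulate oddResidue
    odd⇒∈ j j-odd = subst (_∈ List.tabulate oddResidue) (≡.sym j≡) (∈-tabulate⁺ half)
      where
        half<m = m<2n⇒m/2<n (FinP.toℕ<n j)
        half = Fin.fromℕ< half<m
        j≡ : j ≡ oddResidue half
        j≡ = FinP.toℕ-injective (≡.trans (odd⇒m≡1+2*[m/2] j-odd)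
               (≡.trans (cong (λ q → suc (2 * q)) (≡.sym (FinP.toℕ-fromℕ< half<m)))
                        (≡.sym (toℕ-oddResidue half))))

    ∈⇒odd : ∀ j → j ∈ List.tabulate oddResidue → parity (toℕ j) ≡ 1ℙ
    ∈⇒odd j j∈ with k , j≡ ← ∈-tabulate⁻ j∈ =
      ≡.trans (cong (parity ∘ toℕ) j≡) (≡.trans (cong parity (toℕ-oddResidue k)) (parity[1+2m]≡1ℙ (toℕ k)))

-- The alternating steps (a, b, a, b, …)

-- Definitionally, alternating n a b ≡ tabulate (side a b ∘ toℕ).
side : ℕ → ℕ → ℕ → ℕ
side a b k = if k % 2 ≡ᵇ 0 then a else b

module _ (a b : ℕ) where

  side-cong : ∀ k k' → parity k ≡ parity k' → side a b k ≡ side a b k'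
  side-cong k k' = cong (λ r → if r ≡ᵇ 0 then a else b) ∘ parity-≡⇒%2-≡ k k'

  side-elim : ∀ (P : ℕ → Set) → P a → P b → ∀ k → P (side a b k)
  side-elim P Pa Pb k with k % 2 ≡ᵇ 0
  ... | true  = Pa
  ... | false = Pb

  side+side-suc : ∀ k → side a b k + side a b (suc k) ≡ a + b
  side+side-suc 0             = refl
  side+side-suc 1             = ℕ.+-comm b a
  side+side-suc (suc (suc k)) = side+side-suc k

  partialSum-side : ∀ q r → partialSum (side a b) (q * 2 + r) ≡ partialSum (side a b) r + q * (a + b)
  partialSum-side zero    r = ≡.sym (ℕ.+-identityʳ _)
  partialSum-side (suc q) r = begin
    P k + side a b k + side a b (suc k)     ≡⟨ ℕ.+-assoc (P k) _ _ ⟩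
    P k + (side a b k + side a b (suc k))   ≡⟨ cong₂ _+_ (partialSum-side q r) (side+side-suc k) ⟩
    P r + q * (a + b) + (a + b)             ≡⟨ ℕ.+-assoc (P r) _ _ ⟩
    P r + (q * (a + b) + (a + b))           ≡⟨ cong (_+_ (P r)) (ℕ.+-comm _ (a + b)) ⟩
    P r + suc q * (a + b)                   ∎
    where
      open ≡.≡-Reasoning
      P = partialSum (side a b)
      k = q * 2 + r

side-distinctVertices : ∀ {m t a b} → a + b ≡ 2 * t → Coprime m t →
                        parity a ≡ 1ℙ → parity b ≡ 1ℙ → DistinctVertices (2 * m) (side a b)
side-distinctVertices {m} {t} {a} {b} a+b≡2t m⊥t a-odd b-odd {k} {k'} k<2m k'<2m σk≡σk' =
  ≡.trans (m≡[m/2]*2+m%2 k)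
          (≡.trans (cong₂ (λ q r → q * 2 + r) halves≡ remainders≡) (≡.sym (m≡[m/2]*2+m%2 k')))
  where
    P = partialSum (side a b)

    remainders≡ : k % 2 ≡ k' % 2
    remainders≡ = parity-≡⇒%2-≡ k k' (begin
      parity k        ≡⟨ partialSum-parity (side-elim a b (λ x → parity x ≡ 1ℙ) a-odd b-odd) k ⟨
      parity (P k)    ≡⟨ ≡mod-parity (ℕ.divides m (ℕ.*-comm 2 m)) σk≡σk' ⟩
      parity (P k')   ≡⟨ partialSum-parity (side-elim a b (λ x → parity x ≡ 1ℙ) a-odd b-odd) k' ⟩
      parity k'       ∎)
      where open ≡.≡-Reasoning

    split : ∀ k → + P k ≡ + P (k % 2) ℤ.+ + (k / 2) ℤ.* + (2 * t)
    split k = begin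
      + P k                                       ≡⟨ cong (+_ ∘ P) (m≡[m/2]*2+m%2 k) ⟩
      + P (k / 2 * 2 + k % 2)                     ≡⟨ cong +_ (partialSum-side a b (k / 2) (k % 2)) ⟩
      + (P (k % 2) + k / 2 * (a + b))             ≡⟨ ℤ.pos-+ (P (k % 2)) _ ⟩
      + P (k % 2) ℤ.+ + (k / 2 * (a + b))         ≡⟨ cong (λ w → + P (k % 2) ℤ.+ w) (ℤ.pos-* (k / 2) (a + b)) ⟩
      + P (k % 2) ℤ.+ + (k / 2) ℤ.* + (a + b)     ≡⟨ cong (λ w → + P (k % 2) ℤ.+ + (k / 2) ℤ.* + w) a+b≡2t ⟩
      + P (k % 2) ℤ.+ + (k / 2) ℤ.* + (2 * t)     ∎
      where open ≡.≡-Reasoning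

    halves≡ : k / 2 ≡ k' / 2
    halves≡ = ≡mod⇒≡ (m<2n⇒m/2<n k<2m) (m<2n⇒m/2<n k'<2m)
                     (*-cancelʳ-≡mod 2 m⊥t (+-cancelˡ-≡mod (+ P (k % 2)) halves≡mod))
      where
        open ≡mod-Reasoning (2 * m)
        halves≡mod : + P (k % 2) ℤ.+ + (k / 2) ℤ.* + (2 * t) ≡ + P (k % 2) ℤ.+ + (k' / 2) ℤ.* + (2 * t) mod (2 * m)
        halves≡mod = begin
          + P (k % 2) ℤ.+ + (k / 2) ℤ.* + (2 * t)     ≡⟨ split k ⟨
          + P k                                       ≈⟨ σk≡σk' ⟩
          + P k'                                      ≡⟨ split k' ⟩
          + P (k' % 2) ℤ.+ + (k' / 2) ℤ.* + (2 * t)   ≡⟨ cong (λ r → + P r ℤ.+ + (k' / 2) ℤ.* + (2 * t)) remainders≡ ⟨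
          + P (k % 2) ℤ.+ + (k' / 2) ℤ.* + (2 * t)    ∎

module _ {n : ℕ} (a b : ℕ) (2∣n : 2 ℕ.∣ n) (a-odd : parity a ≡ 1ℙ) (b-odd : parity b ≡ 1ℙ) where

  private
    σ : ℕ → ℤ
    σ k = + partialSum (side a b) k

    e : ℕ → ℤ
    e k = + side a b k

  reflection-parity : ∀ k k' {j} → σ k ℤ.+ σ k' ≡ + j mod n → parity k' ≡ parity k ℙ.+ parity j
  reflection-parity k k' {j} σk+σk'≡j = ℙ-solveʳ (parity k) (begin
    parity k ℙ.+ parity k'                      ≡⟨ cong₂ ℙ._+_ (parity-σ k) (parity-σ k') ⟨
    parity (P k) ℙ.+ parity (P k')              ≡⟨ ℙ.+-homo-+ (P k) (P k') ⟨
    parity (P k + P k')                         ≡⟨ ≡mod-parity 2∣n σk+σk'≡j ⟩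
    parity j                                    ∎)
    where
      open ≡.≡-Reasoning
      P = partialSum (side a b)
      parity-σ = partialSum-parity (side-elim a b (λ x → parity x ≡ 1ℙ) a-odd b-odd)

  oddAxis-mapsEdge : ∀ {j} → parity j ≡ 1ℙ → ∀ k k' →
                     σ (suc k) ℤ.+ σ k' ≡ + j mod n → MapsEdge n (side a b) j k k'
  oddAxis-mapsEdge {j} j-odd k k' σ[1+k]+σk'≡j = inj₂ (≡mod-trans (≡mod-reflexive (begin
      σ k ℤ.+ (σ k' ℤ.+ e k')     ≡⟨ cong (λ w → σ k ℤ.+ (σ k' ℤ.+ w)) same-side ⟩
      σ k ℤ.+ (σ k' ℤ.+ e k)      ≡⟨ swap (σ k) (σ k') (e k) ⟩
      (σ k ℤ.+ e k) ℤ.+ σ k'      ∎)) σ[1+k]+σk'≡j , σ[1+k]+σk'≡j)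
    where
      open ≡.≡-Reasoning
      swap : ∀ x y z → x ℤ.+ (y ℤ.+ z) ≡ (x ℤ.+ z) ℤ.+ y
      swap = solve-∀
      same-side : e k' ≡ e k
      same-side = cong +_ (side-cong a b k' k (begin
        parity k'                     ≡⟨ reflection-parity (suc k) k' σ[1+k]+σk'≡j ⟩
        parity (suc k) ℙ.+ parity j   ≡⟨ cong (parity (suc k) ℙ.+_) j-odd ⟩
        parity (suc k) ℙ.+ 1ℙ         ≡⟨ ℙ.+-homo-+ (suc k) 1 ⟨
        parity (suc k + 1)            ≡⟨ cong parity (ℕ.+-comm (suc k) 1) ⟩
        parity k                      ∎))

  evenAxis-mapsEdge⇒ : ∀ {j} → parity j ≡ 0ℙ → ∀ k k' → MapsEdge n (side a b) j k k' →
                       e k ℤ.+ e k ≡ + 0 mod n ⊎ e (suc k) ≡ e k mod n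
  evenAxis-mapsEdge⇒ {j} j-even k k' (inj₁ (σk+σk'≡j , σ[1+k]+σ[1+k']≡j)) =
    inj₁ (+-cancelˡ-≡mod (σ k ℤ.+ σ k') (begin
      (σ k ℤ.+ σ k') ℤ.+ (e k ℤ.+ e k)     ≡⟨ regroup (σ k) (σ k') (e k) ⟩
      (σ k ℤ.+ e k) ℤ.+ (σ k' ℤ.+ e k)     ≡⟨ cong (λ w → σ (suc k) ℤ.+ (σ k' ℤ.+ w)) same-side ⟩
      σ (suc k) ℤ.+ σ (suc k')             ≈⟨ σ[1+k]+σ[1+k']≡j ⟩
      + j                                  ≈⟨ σk+σk'≡j ⟨
      σ k ℤ.+ σ k'                         ≡⟨ ℤ.+-identityʳ (σ k ℤ.+ σ k') ⟨
      (σ k ℤ.+ σ k') ℤ.+ + 0               ∎))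
    where
      open ≡mod-Reasoning n
      regroup : ∀ x y z → (x ℤ.+ y) ℤ.+ (z ℤ.+ z) ≡ (x ℤ.+ z) ℤ.+ (y ℤ.+ z)
      regroup = solve-∀
      same-side : e k ≡ e k'
      same-side = cong +_ (side-cong a b k k' (≡.sym (≡.trans (reflection-parity k k' σk+σk'≡j)
                            (≡.trans (cong (parity k ℙ.+_) j-even) (ℙ.+-identityʳ (parity k))))))
  evenAxis-mapsEdge⇒ {j} j-even k k' (inj₂ (σk+σ[1+k']≡j , σ[1+k]+σk'≡j)) =
    inj₂ (+-cancelˡ-≡mod (σ k ℤ.+ σ k') (begin
      (σ k ℤ.+ σ k') ℤ.+ e (suc k)         ≡⟨ cong (λ w → σ k ℤ.+ σ k' ℤ.+ w) same-side ⟩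
      (σ k ℤ.+ σ k') ℤ.+ e k'              ≡⟨ ℤ.+-assoc (σ k) (σ k') (e k') ⟩
      σ k ℤ.+ σ (suc k')                   ≈⟨ σk+σ[1+k']≡j ⟩
      + j                                  ≈⟨ σ[1+k]+σk'≡j ⟨
      σ (suc k) ℤ.+ σ k'                   ≡⟨ swap (σ k) (e k) (σ k') ⟩
      (σ k ℤ.+ σ k') ℤ.+ e k               ∎))
    where
      open ≡mod-Reasoning n
      swap : ∀ x y z → (x ℤ.+ y) ℤ.+ z ≡ (x ℤ.+ z) ℤ.+ y
      swap = solve-∀
      same-side : e (suc k) ≡ e k'
      same-side = cong +_ (side-cong a b (suc k) k' (≡.sym (≡.trans (reflection-parity (suc k) k' σ[1+k]+σk'≡j)
                            (≡.trans (cong (parity (suc k) ℙ.+_) j-even) (ℙ.+-identityʳ (parity (suc k)))))))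

  evenAxis-absurd : ∀ {j} → 0 < a → a < b → b < n → parity j ≡ 0ℙ →
                    ∃ (MapsEdge n (side a b) j 0) → ∃ (MapsEdge n (side a b) j 1) → ⊥
  evenAxis-absurd {j} 0<a a<b b<n j-even (k₀ , maps₀) (k₁ , maps₁)
    with evenAxis-mapsEdge⇒ j-even 0 k₀ maps₀ | evenAxis-mapsEdge⇒ j-even 1 k₁ maps₁
  ... | inj₂ b≡a  | _         = ℕ.<-irrefl (≡mod⇒≡ (ℕ.<-trans a<b b<n) b<n (≡mod-sym b≡a)) a<b
  ... | inj₁ _    | inj₂ a≡b  = ℕ.<-irrefl (≡mod⇒≡ (ℕ.<-trans a<b b<n) b<n a≡b) a<b
  ... | inj₁ 2a≡0 | inj₁ 2b≡0 = ℕ.<-irrefl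
        (≡.trans (double≡0-mod⇒double≡n 0<a (ℕ.<-trans a<b b<n) 2a≡0)
                 (≡.sym (double≡0-mod⇒double≡n (ℕ.<-trans 0<a a<b) b<n 2b≡0)))
        (ℕ.+-mono-< a<b a<b)

module _ {m t a b : ℕ} .{{_ : NonZero (2 * m)}} (a+b≡2t : a + b ≡ 2 * t) (m⊥t : Coprime m t)
         (a-odd : parity a ≡ 1ℙ) (b-odd : parity b ≡ 1ℙ)
         (1≤a : 1 ≤ a) (a<b : a < b) (b≤n∸1 : b ≤ 2 * m ∸ 1) where

  private
    n = 2 * m

    distinct : DistinctVertices n (side a b)
    distinct = side-distinctVertices a+b≡2t m⊥t a-odd b-odd

  alternating-representsPolygon : RepresentsPolygon n (alternating n a b)
  alternating-representsPolygon =
    All.tabulate⁺ (side-elim a b _ a-bounds b-bounds ∘ toℕ) , vertexSeq-injective distinct , closes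
    where
      open ≡.≡-Reasoning
      a-bounds = 1≤a , ℕ.≤-trans (ℕ.<⇒≤ a<b) b≤n∸1
      b-bounds = ℕ.≤-trans 1≤a (ℕ.<⇒≤ a<b) , b≤n∸1
      rotate : ∀ m t → m * (2 * t) ≡ t * (2 * m)
      rotate = ℕ-solve-∀
      2m≡m*2+0 : 2 * m ≡ m * 2 + 0
      2m≡m*2+0 = ≡.trans (ℕ.*-comm 2 m) (≡.sym (ℕ.+-identityʳ (m * 2)))
      closes : sum (alternating n a b) % n ≡ 0
      closes = begin
        sum (alternating n a b) % n                 ≡⟨ cong (_% n) (sum-tabulate n (side a b)) ⟩
        partialSum (side a b) (2 * m) % n           ≡⟨ cong (λ k → partialSum (side a b) k % n) 2m≡m*2+0 ⟩
        partialSum (side a b) (m * 2 + 0) % n       ≡⟨ cong (_% n) (partialSum-side a b m 0) ⟩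
        m * (a + b) % n                             ≡⟨ cong (λ s → m * s % n) a+b≡2t ⟩
        m * (2 * t) % n                             ≡⟨ cong (_% n) (rotate m t) ⟩
        t * n % n                                   ≡⟨ m*n%n≡0 t n ⟩
        0                                           ∎

  alternating-isAxis⇔odd : ∀ j → IsAxis n (alternating n a b) j ⇔ parity (toℕ j) ≡ 1ℙ
  alternating-isAxis⇔odd j = mk⇔ axis⇒odd odd⇒axis
    where
      2∣n : 2 ℕ.∣ n
      2∣n = ℕ.divides m (ℕ.*-comm 2 m)
      b<n : b < n
      b<n = ℕ.m≤pred[n]⇒suc[m]≤n (subst (b ≤_) (≡.sym (ℕ.pred[m∸n]≡m∸[1+n] n 0)) b≤n∸1)
      P = partialSum (side a b)
      isAxis⇔ = isAxis-tabulate⇔ n (side a b) j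

      axis⇒odd : IsAxis n (alternating n a b) j → parity (toℕ j) ≡ 1ℙ
      axis⇒odd axis with parity (toℕ j) in j-parity
      ... | 1ℙ = refl
      ... | 0ℙ = ⊥-elim (evenAxis-absurd a b 2∣n a-odd b-odd 1≤a a<b b<n j-parity (edge 0<n) (edge 1<n))
        where
          1<n = ℕ.≤-<-trans 1≤a (ℕ.<-trans a<b b<n)
          0<n = ℕ.<-trans ℕ.z<s 1<n
          edge : ∀ {k} → k < n → ∃ (MapsEdge n (side a b) (toℕ j) k)
          edge {k} k<n with i' , maps ← Equivalence.to isAxis⇔ axis (Fin.fromℕ< k<n) =
            toℕ i' , subst (λ k → MapsEdge n (side a b) (toℕ j) k (toℕ i')) (FinP.toℕ-fromℕ< k<n) maps

      odd⇒axis : parity (toℕ j) ≡ 1ℙ → IsAxis n (alternating n a b) j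
      odd⇒axis j-odd = Equivalence.from isAxis⇔ (λ i → mirror-edge (toℕ i))
        where
          mirror-edge : ∀ k → ∃ λ (i' : Fin n) → MapsEdge n (side a b) (toℕ j) k (toℕ i')
          mirror-edge k = Prod.map₂ (λ {i'} → mirrored (toℕ i')) (vertices-cover distinct mirror)
            where
              mirror = reflect n j (P (suc k) % n)
              mirrored : ∀ k' → + P k' ≡ + mirror mod n → MapsEdge n (side a b) (toℕ j) k k'
              mirrored k' σk'≡mirror = oddAxis-mapsEdge a b 2∣n a-odd b-odd j-odd k k'
                (≡mod-trans (+-cong-≡mod (≡mod-refl {x = + P (suc k)}) σk'≡mirror) (reflect-≡mod n j (P (suc k))))

theorem6 : (m n : ℕ) → n ≡ 2 * m → 3 < n → .{{_ : NonZero n}} → (a b : ℕ) →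
    1 ≤ a → a < b → b ≤ n ∸ 1 → a % 2 ≡ 1 → b % 2 ≡ 1 → gcd (a + b) n ≡ 2 →
    RepresentsPolygon n (alternating n a b) × HasExactlyAxes n (alternating n a b) m
theorem6 m _ refl _ a b 1≤a a<b b≤n∸1 a%2≡1 b%2≡1 gcd≡2 =
  alternating-representsPolygon a+b≡2t m⊥t a-odd b-odd 1≤a a<b b≤n∸1 ,
  oddAxes⇒hasExactlyAxes (alternating (2 * m) a b)
    (alternating-isAxis⇔odd a+b≡2t m⊥t a-odd b-odd 1≤a a<b b≤n∸1)
  where
    a-odd = m%2≡1⇒parity≡1ℙ a a%2≡1
    b-odd = m%2≡1⇒parity≡1ℙ b b%2≡1
    a+b≡2t : a + b ≡ 2 * ((a + b) / 2)
    a+b≡2t = even⇒m≡2*[m/2] (≡.trans (ℙ.+-homo-+ a b) (cong₂ ℙ._+_ a-odd b-odd))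
    m⊥t : Coprime m ((a + b) / 2)
    m⊥t = gcd[dt,dm]≡d⇒coprime 2 (subst (λ s → gcd s (2 * m) ≡ 2) a+b≡2t gcd≡2)
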